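{- Let $k,r\in\{1,2\}$ and let $D$ be a digraph with $\delta^-(D)\ge r-1$. Then $L_k(D)\le \frac{k}{r}\gamma_{\times r}(D)$. This bound is sharp (attained by some digraphs).
   Context: Digraphs are finite, without loops or multiple arcs (opposite arcs allowed). $\delta^-(D)$ is the minimum in-degree, $N^+[v]=N^+(v)\cup\{v\}$. A vertex dominates itself and its out-neighbours. For $k\in\{1,2\}$, a $k$-limited packing is a set $B\subseteq V(D)$ with $|N^+[v]\cap B|\le k$ for every vertex $v$; $L_k(D)$ is its maximum size ($L_1(D)=\rho(D)$ is the packing number). For $r\in\{1,2\}$, an $r$-tuple dominating set is a set $S$ such that every vertex of $D$ is dominated by at least $r$ vertices of $S$ (for $r=1$ this is a dominating set, for $r=2$ a double dominating set); $\gamma_{\times r}(D)$ is its minimum size, so $\gamma_{\times1}(D)=\gamma(D)$. -}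

module Defs where

open import Data.Nat using (ℕ; _≤_; _∸_; _*_)
open import Data.Bool using (Bool; false; _∨_)
open import Data.Fin using (Fin; _≟_)
open import Data.Fin.Subset using (Subset; ∣_∣; _∩_)
open import Data.Vec using (tabulate)
open import Relation.Nullary.Decidable using (⌊_⌋)
open import Relation.Binary.PropositionalEquality using (_≡_)

record Digraph : Set where
  field
    n        : ℕ
    adj      : Fin n → Fin n → Bool
    loopless : ∀ v → adj v v ≡ false
open Digraph public

indeg : (D : Digraph) → Fin (n D) → ℕ
indeg D v = ∣ tabulate (λ u → adj D u v) ∣

MinInDegGE : Digraph → ℕ → Set
MinInDegGE D m = ∀ v → m ≤ indeg D v

N⁺[_] : {D : Digraph} → Fin (n D) → Subset (n D)
N⁺[_] {D} v = tabulate (λ u → adj D v u ∨ ⌊ v ≟ u ⌋)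

N⁻[_] : {D : Digraph} → Fin (n D) → Subset (n D)
N⁻[_] {D} v = tabulate (λ u → adj D u v ∨ ⌊ u ≟ v ⌋)

IsLimitedPacking : (D : Digraph) → ℕ → Subset (n D) → Set
IsLimitedPacking D k B = ∀ v → ∣ N⁺[_] {D} v ∩ B ∣ ≤ k

IsTupleDominating : (D : Digraph) → ℕ → Subset (n D) → Set
IsTupleDominating D r S = ∀ v → r ≤ ∣ N⁻[_] {D} v ∩ S ∣

IsLk : (D : Digraph) → ℕ → ℕ → Set
IsLk D k m =
  (Data.Product.Σ (Subset (n D)) λ B → IsLimitedPacking D k B Data.Product.× ∣ B ∣ ≡ m)
  Data.Product.× (∀ B → IsLimitedPacking D k B → ∣ B ∣ ≤ m)
  where import Data.Product

IsGammaTimes : (D : Digraph) → ℕ → ℕ → Set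
IsGammaTimes D r g =
  (Data.Product.Σ (Subset (n D)) λ S → IsTupleDominating D r S Data.Product.× ∣ S ∣ ≡ g)
  Data.Product.× (∀ S → IsTupleDominating D r S → g ≤ ∣ S ∣)
  where import Data.Product

-- Double counting: every vertex of B is dominated by at least r vertices of S,
-- and every vertex of S dominates at most k vertices of B, so counting the
-- pairs (u, v) ∈ S × B with u dominating v gives r·|B| ≤ k·|S|. Equality holds
-- for the 2-cycle, where every vertex dominates everything: there L_k = k and
-- γ_{×r} = r.
module Submission where

open import Defs
open import Data.Bool using (Bool; true; false; _∧_; _∨_; not)
open import Data.Fin using (Fin; zero; suc; _≟_)
open import Data.Fin.Subset using (Subset; ∣_∣; _∩_)
open import Data.Nat as ℕ using (ℕ; _≤_; _*_; _∸_; _+_; z≤n; s≤s)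
open import Data.Nat.Properties
  using (module ≤-Reasoning; +-*-semiring; +-mono-≤; *-monoʳ-≤; *-identityˡ; *-comm; *-assoc;
         ≤-refl; ≤-reflexive; ∸-monoˡ-≤)
open import Data.Product using (Σ; _×_; _,_)
open import Data.Sum using (_⊎_; inj₁; inj₂)
open import Data.Vec using ([]; _∷_; lookup; tabulate)
open import Function using (_∘_)
open import Relation.Binary.PropositionalEquality
  using (_≡_; refl; sym; trans; cong; cong₂; subst; module ≡-Reasoning)
open import Relation.Nullary.Decidable using (⌊_⌋; isYes≗does; dec-true)

open import Algebra.Properties.Semiring.Sum +-*-semiring
  using (sum; sum-syntax; ∑-comm; *-distribˡ-sum; sum-cong-≗)

𝟙 : Bool → ℕ
𝟙 true  = 1
𝟙 false = 0

𝟙-∧ : ∀ x y → 𝟙 (x ∧ y) ≡ 𝟙 x * 𝟙 y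
𝟙-∧ true  y = sym (*-identityˡ (𝟙 y))
𝟙-∧ false y = refl

∣x∷p∣≡𝟙x+∣p∣ : ∀ {n} x (p : Subset n) → ∣ x ∷ p ∣ ≡ 𝟙 x + ∣ p ∣
∣x∷p∣≡𝟙x+∣p∣ true  p = refl
∣x∷p∣≡𝟙x+∣p∣ false p = refl

∣p∣≡∑𝟙 : ∀ {n} (p : Subset n) → ∣ p ∣ ≡ ∑[ i < n ] 𝟙 (lookup p i)
∣p∣≡∑𝟙 []      = refl
∣p∣≡∑𝟙 (x ∷ p) = trans (∣x∷p∣≡𝟙x+∣p∣ x p) (cong (𝟙 x +_) (∣p∣≡∑𝟙 p))

∣tabulate∩q∣≡∑ : ∀ {n} (f : Fin n → Bool) (q : Subset n) →
                 ∣ tabulate f ∩ q ∣ ≡ ∑[ i < n ] (𝟙 (f i) * 𝟙 (lookup q i))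
∣tabulate∩q∣≡∑ f []      = refl
∣tabulate∩q∣≡∑ f (x ∷ q) =
  trans (∣x∷p∣≡𝟙x+∣p∣ (f zero ∧ x) (tabulate (λ i → f (suc i)) ∩ q))
        (cong₂ _+_ (𝟙-∧ (f zero) x) (∣tabulate∩q∣≡∑ (λ i → f (suc i)) q))

c*∣p∣≡∑ : ∀ {n} c (p : Subset n) → c * ∣ p ∣ ≡ ∑[ i < n ] (𝟙 (lookup p i) * c)
c*∣p∣≡∑ {n} c p = begin
  c * ∣ p ∣                       ≡⟨ cong (c *_) (∣p∣≡∑𝟙 p) ⟩
  c * sum (λ i → 𝟙 (lookup p i))  ≡⟨ *-distribˡ-sum c (λ i → 𝟙 (lookup p i)) ⟩
  sum (λ i → c * 𝟙 (lookup p i))  ≡⟨ sum-cong-≗ {n} (λ i → *-comm c (𝟙 (lookup p i))) ⟩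
  sum (λ i → 𝟙 (lookup p i) * c)  ∎
  where open ≡-Reasoning

sum-mono-≤ : ∀ {n} {f g : Fin n → ℕ} → (∀ i → f i ≤ g i) → sum f ≤ sum g
sum-mono-≤ {ℕ.zero}  f≤g = z≤n
sum-mono-≤ {ℕ.suc n} f≤g = +-mono-≤ (f≤g zero) (sum-mono-≤ (λ i → f≤g (suc i)))

∑-double-counting : ∀ {m n} (a : Fin n → ℕ) (w : Fin m → Fin n → ℕ) (b : Fin m → ℕ) →
  ∑[ v < n ] (a v * ∑[ u < m ] (w u v * b u)) ≡ ∑[ u < m ] (b u * ∑[ v < n ] (w u v * a v))
∑-double-counting {m} {n} a w b = begin
  ∑[ v < n ] (a v * ∑[ u < m ] (w u v * b u))
    ≡⟨ sum-cong-≗ {n} (λ v → *-distribˡ-sum (a v) (λ u → w u v * b u)) ⟩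
  ∑[ v < n ] ∑[ u < m ] (a v * (w u v * b u))
    ≡⟨ ∑-comm (λ v u → a v * (w u v * b u)) ⟩
  ∑[ u < m ] ∑[ v < n ] (a v * (w u v * b u))
    ≡⟨ sum-cong-≗ {m} (λ u → sum-cong-≗ {n} (λ v → swap (a v) (w u v) (b u))) ⟩
  ∑[ u < m ] ∑[ v < n ] (b u * (w u v * a v))
    ≡⟨ sum-cong-≗ {m} (λ u → *-distribˡ-sum (b u) (λ v → w u v * a v)) ⟨
  ∑[ u < m ] (b u * ∑[ v < n ] (w u v * a v))
    ∎
  where
  open ≡-Reasoning
  swap : ∀ x y z → x * (y * z) ≡ z * (y * x)
  swap x y z = begin
    x * (y * z)  ≡⟨ *-comm x _ ⟩
    (y * z) * x  ≡⟨ cong (_* x) (*-comm y z) ⟩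
    (z * y) * x  ≡⟨ *-assoc z y x ⟩
    z * (y * x)  ∎

module _ {m n} (R : Fin m → Fin n → Bool) (S : Subset m) (B : Subset n) where

  ∑∣column∩S∣≡∑∣row∩B∣ :
    ∑[ v < n ] (𝟙 (lookup B v) * ∣ tabulate (λ u → R u v) ∩ S ∣) ≡
    ∑[ u < m ] (𝟙 (lookup S u) * ∣ tabulate (R u) ∩ B ∣)
  ∑∣column∩S∣≡∑∣row∩B∣ = begin
    ∑[ v < n ] (𝟙 (lookup B v) * ∣ tabulate (λ u → R u v) ∩ S ∣)
      ≡⟨ sum-cong-≗ {n} (λ v → cong (𝟙 (lookup B v) *_) (∣tabulate∩q∣≡∑ (λ u → R u v) S)) ⟩
    ∑[ v < n ] (𝟙 (lookup B v) * ∑[ u < m ] (𝟙 (R u v) * 𝟙 (lookup S u)))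
      ≡⟨ ∑-double-counting (𝟙 ∘ lookup B) (λ u v → 𝟙 (R u v)) (𝟙 ∘ lookup S) ⟩
    ∑[ u < m ] (𝟙 (lookup S u) * ∑[ v < n ] (𝟙 (R u v) * 𝟙 (lookup B v)))
      ≡⟨ sum-cong-≗ {m} (λ u → cong (𝟙 (lookup S u) *_) (∣tabulate∩q∣≡∑ (R u) B)) ⟨
    ∑[ u < m ] (𝟙 (lookup S u) * ∣ tabulate (R u) ∩ B ∣)
      ∎
    where open ≡-Reasoning

  incidence-bound : ∀ {r k} →
    (∀ v → r ≤ ∣ tabulate (λ u → R u v) ∩ S ∣) → (∀ u → ∣ tabulate (R u) ∩ B ∣ ≤ k) →
    r * ∣ B ∣ ≤ k * ∣ S ∣
  incidence-bound {r} {k} r≤column row≤k = begin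
    r * ∣ B ∣
      ≡⟨ c*∣p∣≡∑ r B ⟩
    ∑[ v < n ] (𝟙 (lookup B v) * r)
      ≤⟨ sum-mono-≤ (λ v → *-monoʳ-≤ (𝟙 (lookup B v)) (r≤column v)) ⟩
    ∑[ v < n ] (𝟙 (lookup B v) * ∣ tabulate (λ u → R u v) ∩ S ∣)
      ≡⟨ ∑∣column∩S∣≡∑∣row∩B∣ ⟩
    ∑[ u < m ] (𝟙 (lookup S u) * ∣ tabulate (R u) ∩ B ∣)
      ≤⟨ sum-mono-≤ (λ u → *-monoʳ-≤ (𝟙 (lookup S u)) (row≤k u)) ⟩
    ∑[ u < m ] (𝟙 (lookup S u) * k)
      ≡⟨ c*∣p∣≡∑ k S ⟨
    k * ∣ S ∣
      ∎
    where open ≤-Reasoning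

-- N⁺[ u ] and N⁻[ v ] are definitionally the row and the column of this relation.
dominates : (D : Digraph) → Fin (n D) → Fin (n D) → Bool
dominates D u v = adj D u v ∨ ⌊ u ≟ v ⌋

packing-size-≤-dominating-size : ∀ D {k r B S} →
  IsLimitedPacking D k B → IsTupleDominating D r S → r * ∣ B ∣ ≤ k * ∣ S ∣
packing-size-≤-dominating-size D {B = B} {S} B-packing S-dominating =
  incidence-bound (dominates D) S B S-dominating B-packing

r*Lk≤k*γ× : ∀ D {k r l g} → IsLk D k l → IsGammaTimes D r g → r * l ≤ k * g
r*Lk≤k*γ× D ((B , B-packing , refl) , _) ((S , S-dominating , refl) , _) =
  packing-size-≤-dominating-size D B-packing S-dominating

completeDigraph : ℕ → Digraph
completeDigraph m = record
  { n        = m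
  ; adj      = λ u v → not ⌊ u ≟ v ⌋
  ; loopless = λ v → cong not (trans (isYes≗does (v ≟ v)) (dec-true (v ≟ v) refl))
  }

K₂ : Digraph
K₂ = completeDigraph 2

K₂-N⁺[v]∩B≡B : ∀ v (B : Subset 2) → N⁺[_] {K₂} v ∩ B ≡ B
K₂-N⁺[v]∩B≡B zero       (x ∷ y ∷ []) = refl
K₂-N⁺[v]∩B≡B (suc zero) (x ∷ y ∷ []) = refl

K₂-N⁻[v]∩S≡S : ∀ v (S : Subset 2) → N⁻[_] {K₂} v ∩ S ≡ S
K₂-N⁻[v]∩S≡S zero       (x ∷ y ∷ []) = refl
K₂-N⁻[v]∩S≡S (suc zero) (x ∷ y ∷ []) = refl

K₂-MinInDegGE : ∀ {m} → m ≤ 1 → MinInDegGE K₂ m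
K₂-MinInDegGE m≤1 zero       = m≤1
K₂-MinInDegGE m≤1 (suc zero) = m≤1

subset₂-of-size : ∀ {k} → k ≤ 2 → Σ (Subset 2) λ B → ∣ B ∣ ≡ k
subset₂-of-size z≤n             = false ∷ false ∷ [] , refl
subset₂-of-size (s≤s z≤n)       = true ∷ false ∷ [] , refl
subset₂-of-size (s≤s (s≤s z≤n)) = true ∷ true ∷ [] , refl

K₂-Lk : ∀ {k} → k ≤ 2 → IsLk K₂ k k
K₂-Lk k≤2 with subset₂-of-size k≤2
... | B , refl = (B , packing , refl) , packing-size
  where
  packing : IsLimitedPacking K₂ ∣ B ∣ B
  packing v = ≤-reflexive (cong ∣_∣ (K₂-N⁺[v]∩B≡B v B))
  packing-size : ∀ B′ → IsLimitedPacking K₂ ∣ B ∣ B′ → ∣ B′ ∣ ≤ ∣ B ∣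
  packing-size B′ B′-packing =
    subst (_≤ ∣ B ∣) (cong ∣_∣ (K₂-N⁺[v]∩B≡B zero B′)) (B′-packing zero)

K₂-γ× : ∀ {r} → r ≤ 2 → IsGammaTimes K₂ r r
K₂-γ× r≤2 with subset₂-of-size r≤2
... | S , refl = (S , dominating , refl) , dominating-size
  where
  dominating : IsTupleDominating K₂ ∣ S ∣ S
  dominating v = ≤-reflexive (cong ∣_∣ (sym (K₂-N⁻[v]∩S≡S v S)))
  dominating-size : ∀ S′ → IsTupleDominating K₂ ∣ S ∣ S′ → ∣ S ∣ ≤ ∣ S′ ∣
  dominating-size S′ S′-dominating =
    subst (∣ S ∣ ≤_) (cong ∣_∣ (K₂-N⁻[v]∩S≡S zero S′)) (S′-dominating zero)

proposition2 : (k r : ℕ) → (k ≡ 1 ⊎ k ≡ 2) → (r ≡ 1 ⊎ r ≡ 2) →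
    ((D : Digraph) → MinInDegGE D (r ∸ 1) →
      (l g : ℕ) → IsLk D k l → IsGammaTimes D r g → r * l ≤ k * g)
    × (Σ Digraph λ D → 1 ≤ n D × MinInDegGE D (r ∸ 1) × Σ ℕ λ l → Σ ℕ λ g →
      IsLk D k l × IsGammaTimes D r g × r * l ≡ k * g)
proposition2 k r k∈12 r∈12 =
  -- The in-degree condition only guarantees that an r-tuple dominating set
  -- exists; IsGammaTimes already provides one.
  (λ D _ l g → r*Lk≤k*γ× D) ,
  (K₂ , s≤s z≤n , K₂-MinInDegGE (∸-monoˡ-≤ 1 (one-or-two⇒≤2 r∈12)) ,
   k , r , K₂-Lk (one-or-two⇒≤2 k∈12) , K₂-γ× (one-or-two⇒≤2 r∈12) , *-comm r k)
  where
  one-or-two⇒≤2 : ∀ {m} → m ≡ 1 ⊎ m ≡ 2 → m ≤ 2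
  one-or-two⇒≤2 (inj₁ refl) = s≤s z≤n
  one-or-two⇒≤2 (inj₂ refl) = ≤-refl
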